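{- Every finite differentiable $O$-sequence is a pure $O$-sequence.
   Context: For positive integers $n,d$, write $n=\binom{k_d}{d}+\cdots+\binom{k_\delta}{\delta}$ with $k_d>\dots>k_\delta\ge\delta\ge1$ (unique $d$-binomial expansion) and set $(n_{(d)})^1_1=\binom{k_d+1}{d+1}+\cdots+\binom{k_\delta+1}{\delta+1}$; set $(0_{(d)})^1_1=0$. A sequence $(h_0,\dots,h_e)$ of non-negative integers with $h_0=1$ is an $O$-sequence if $h_{d+1}\le((h_d)_{(d)})^1_1$ for all $1\le d<e$. A monomial order ideal is a finite nonempty set of monomials closed under taking divisors; it is pure if all its maximal monomials under divisibility have the same degree $e$. A pure $O$-sequence is the vector counting the monomials of each degree $0,\dots,e$ in a pure monomial order ideal. A sequence $(h_0,\dots,h_e)$ is differentiable if $(h_0,h_1-h_0,\dots,h_e-h_{e-1})$ is an $O$-sequence. -}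

module Defs where

open import Data.Nat using (ℕ; zero; suc; _+_; _∸_; _≤_; _<_; _≤?_; _≟_)
open import Data.Nat.Combinatorics using (_C_)
open import Data.Product using (Σ; _×_; _,_)
open import Data.List using (List; []; _∷_; length; filter)
open import Data.Vec using (Vec) renaming (sum to vsum)
open import Data.Vec.Relation.Binary.Pointwise.Inductive using (Pointwise)
open import Data.List.Membership.Propositional using (_∈_)
open import Data.List.Relation.Unary.Unique.Propositional using (Unique)
open import Relation.Binary.PropositionalEquality using (_≡_; _≢_)
open import Relation.Nullary using (yes; no)

-- Largest k < b with (k C d) ≤ n (0 if none).
largestBelow : ℕ → ℕ → ℕ → ℕ
largestBelow zero    d n = 0
largestBelow (suc b) d n with (b C d) ≤? n
... | yes _ = b
... | no  _ = largestBelow b d n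

-- The greedy d-binomial expansion of n: list of pairs (k_i , i),
-- n = Σ (k_i C i), k_d > k_{d-1} > ... > k_δ ≥ δ ≥ 1.
-- For d ≥ 1 the largest k with (k C d) ≤ n satisfies k < n + d + 1.
binExp : ℕ → ℕ → List (ℕ × ℕ)
binExp zero    n       = []
binExp (suc d) zero    = []
binExp (suc d) (suc m) =
  let k = largestBelow (suc m + suc d + 1) (suc d) (suc m)
  in (k , suc d) ∷ binExp d (suc m ∸ (k C suc d))

-- (n_(d))^1_1 = Σ ((k_i + 1) C (i + 1)); equals 0 for n = 0.
upperSum : List (ℕ × ℕ) → ℕ
upperSum []             = 0
upperSum ((k , i) ∷ xs) = (suc k C suc i) + upperSum xs

macaulayUp : ℕ → ℕ → ℕ
macaulayUp d n = upperSum (binExp d n)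

-- A finite sequence (h 0, ..., h e) is represented by e and h : ℕ → ℕ
-- (values at indices > e are irrelevant).
IsOSequence : ℕ → (ℕ → ℕ) → Set
IsOSequence e h = (h 0 ≡ 1) × (∀ d → 1 ≤ d → d < e → h (suc d) ≤ macaulayUp d (h d))

Δ : (ℕ → ℕ) → ℕ → ℕ
Δ h zero    = h 0
Δ h (suc d) = h (suc d) ∸ h d

-- differentiable: the differences are non-negative integers and form an O-sequence
IsDifferentiable : ℕ → (ℕ → ℕ) → Set
IsDifferentiable e h = (∀ d → d < e → h d ≤ h (suc d)) × IsOSequence e (Δ h)

Monomial : ℕ → Set
Monomial r = Vec ℕ r

deg : ∀ {r} → Monomial r → ℕ
deg = vsum

_∣ᵐ_ : ∀ {r} → Monomial r → Monomial r → Set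
m ∣ᵐ m' = Pointwise _≤_ m m'

IsOrderIdeal : ∀ {r} → List (Monomial r) → Set
IsOrderIdeal {r} I =
  (I ≢ []) × Unique I × (∀ m m' → m' ∈ I → m ∣ᵐ m' → m ∈ I)

IsMaximalIn : ∀ {r} → List (Monomial r) → Monomial r → Set
IsMaximalIn {r} I m = (m ∈ I) × (∀ m' → m' ∈ I → m ∣ᵐ m' → m' ≡ m)

IsPureOfDegree : ∀ {r} → ℕ → List (Monomial r) → Set
IsPureOfDegree e I = ∀ m → IsMaximalIn I m → deg m ≡ e

countDeg : ∀ {r} → ℕ → List (Monomial r) → ℕ
countDeg d I = length (filter (λ m → deg m ≟ d) I)

IsPureOSequence : ℕ → (ℕ → ℕ) → Set
IsPureOSequence e h =
  Σ ℕ λ r → Σ (List (Monomial r)) λ I →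
    IsOrderIdeal I × IsPureOfDegree e I × (∀ d → d ≤ e → countDeg d I ≡ h d)

module Submission where

-- Let h = (h 0, …, h e) be an O-sequence whose first
-- difference g = Δ h is again an O-sequence.  Put R = h e and order the
-- monomials of each degree d in R + 1 variables by a "rank" in
-- [0, C(R+d, d)) (a combinatorial number system: monomials free of the first
-- variable x₀ come first, then x₀ times the monomials of degree d − 1).
-- Macaulay's identity says that multiplying by the last variable sends the
-- monomial of rank n to the one of rank (n_(d))^1_1, and that this is the
-- least rank among all multiples by one variable of monomials of rank ≥ n.
-- Hence, g being an O-sequence, the "segment" {t : rank t < g (deg t)} is
-- closed under divisors (the easy half of Macaulay's theorem).  Adjoining one
-- new variable x₀, the monomials x₀^a · t with a + deg t ≤ e and t in the
-- segment form an order ideal; it is pure of degree e (raise a), and its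
-- degree-D part has g 0 + … + g D = h D elements.  The file develops, in
-- order: binomial facts, the greedy binomial expansion, rank/unrank,
-- Macaulay's identity, segments, graded concatenation of lists, the
-- construction of the ideal, and finally the corollary.

open import Data.Nat using (ℕ; zero; suc; _+_; _∸_; _≤_; _<_; _≤′_; ≤′-reflexive; ≤′-step; z≤n; s≤s; _≤?_; _≟_)
open import Data.Nat.Properties
open import Data.Nat.Combinatorics using (_C_; nCk+nC[k+1]≡[n+1]C[k+1]; nCn≡1; nC1≡n)
open import Data.Vec using (Vec; []; _∷_; head; tail)
open import Data.Vec.Relation.Binary.Pointwise.Inductive as Pointwise using ([]; _∷_)
open import Data.List using (List; []; _∷_; _++_; length; filter; applyUpTo)
open import Data.List.Properties
  using (length-++; length-applyUpTo; filter-all; filter-none; filter-++; ++-identityʳ)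
open import Data.List.Membership.Propositional using (_∈_)
open import Data.List.Membership.Propositional.Properties
  using (∈-++⁻; ∈-++⁺ˡ; ∈-++⁺ʳ; ∈-applyUpTo⁺; ∈-applyUpTo⁻)
open import Data.List.Relation.Unary.All as All using ()
open import Data.List.Relation.Unary.AllPairs.Properties using (applyUpTo⁺₁)
open import Data.List.Relation.Unary.Unique.Propositional using (Unique)
open import Data.List.Relation.Unary.Unique.Propositional.Properties using (++⁺)
open import Data.Product using (Σ; _×_; _,_; proj₁; proj₂)
open import Data.Sum using (_⊎_; inj₁; inj₂)
open import Data.Empty using (⊥-elim)
open import Relation.Nullary using (yes; no)
open import Relation.Binary.PropositionalEquality

open import Defs

C-step : ∀ n k → n C k ≤ suc n C k
C-step n zero    = ≤-refl
C-step n (suc k) = subst (n C suc k ≤_) (nCk+nC[k+1]≡[n+1]C[k+1] n k) (m≤n+m _ _)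

C-mono : ∀ k {n m} → n ≤ m → n C k ≤ m C k
C-mono k n≤m = go (≤⇒≤′ n≤m)
  where
  go : ∀ {n m} → n ≤′ m → n C k ≤ m C k
  go (≤′-reflexive refl) = ≤-refl
  go (≤′-step n≤′m)      = ≤-trans (go n≤′m) (C-step _ k)

-- The number of monomials of degree d in R + 1 variables.
monCount : ℕ → ℕ → ℕ
monCount R d = (R + d) C d

-- The degree-(d+1) monomials in R + 2 variables are those free of the first
-- variable x₀ (degree d + 1 in R + 1 variables) and x₀ times those of degree d.
monCount-pascal : ∀ R d → monCount R (suc d) + monCount (suc R) d ≡ monCount (suc R) (suc d)
monCount-pascal R d = begin
  (R + suc d) C suc d + (suc R + d) C d  ≡⟨ cong (λ n → n C suc d + (suc R + d) C d) (+-suc R d) ⟩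
  (suc R + d) C suc d + (suc R + d) C d  ≡⟨ +-comm ((suc R + d) C suc d) _ ⟩
  (suc R + d) C d + (suc R + d) C suc d  ≡⟨ nCk+nC[k+1]≡[n+1]C[k+1] (suc R + d) d ⟩
  suc (suc R + d) C suc d                ≡⟨ cong (λ n → suc n C suc d) (sym (+-suc R d)) ⟩
  (suc R + suc d) C suc d                ∎
  where open ≡-Reasoning

monCount-suc : ∀ R d → monCount R d ≤ monCount R (suc d)
monCount-suc R d = subst (monCount R d ≤_) eq (m≤m+n _ _)
  where
  eq : (R + d) C d + (R + d) C suc d ≡ monCount R (suc d)
  eq = trans (nCk+nC[k+1]≡[n+1]C[k+1] (R + d) d) (cong (_C suc d) (sym (+-suc R d)))

-- In positive degree each of the R + 1 variables has its own pure power.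
monCount-large : ∀ R d → suc R ≤ monCount R (suc d)
monCount-large R zero    = ≤-reflexive (sym (trans (nC1≡n (R + 1)) (+-comm R 1)))
monCount-large R (suc d) = ≤-trans (monCount-large R d) (monCount-suc R (suc d))

largestBelow-unique : ∀ B d n b → b < B → b C d ≤ n → n < suc b C d → largestBelow B d n ≡ b
largestBelow-unique (suc B) d n b b<1+B lo hi with (B C d) ≤? n | m≤n⇒m<n∨m≡n (≤-pred b<1+B)
... | yes _   | inj₂ refl = refl
... | no  B≰n | inj₂ refl = ⊥-elim (B≰n lo)
... | yes B≤n | inj₁ b<B  = ⊥-elim (<⇒≱ hi (≤-trans (C-mono d b<B) B≤n))
... | no  _   | inj₁ b<B  = largestBelow-unique B d n b b<B lo hi

macaulayUp-step : ∀ d n k → 0 < n → k ≤ n + suc d → k C suc d ≤ n → n < suc k C suc d →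
  macaulayUp (suc d) n ≡ suc k C suc (suc d) + macaulayUp d (n ∸ k C suc d)
macaulayUp-step d (suc m) k _ k≤ lo hi =
  cong (λ b → suc b C suc (suc d) + macaulayUp d (suc m ∸ b C suc d))
    (largestBelow-unique (suc m + suc d + 1) (suc d) (suc m) k
      (≤-trans (s≤s k≤) (≤-reflexive (+-comm 1 _))) lo hi)

macaulayUp-zero : ∀ d → macaulayUp d 0 ≡ 0
macaulayUp-zero zero    = refl
macaulayUp-zero (suc d) = refl

bumpFirst : ∀ {R} → Vec ℕ (suc R) → Vec ℕ (suc R)
bumpFirst (c ∷ t) = suc c ∷ t

deg-bumpFirst : ∀ {R} (v : Vec ℕ (suc R)) → deg (bumpFirst v) ≡ suc (deg v)
deg-bumpFirst (c ∷ t) = refl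

bumpLast : ∀ {R} → Vec ℕ (suc R) → Vec ℕ (suc R)
bumpLast {zero}  (c ∷ []) = suc c ∷ []
bumpLast {suc R} (c ∷ t)  = c ∷ bumpLast t

deg-bumpLast : ∀ {R} (v : Vec ℕ (suc R)) → deg (bumpLast v) ≡ suc (deg v)
deg-bumpLast {zero}  (c ∷ []) = refl
deg-bumpLast {suc R} (c ∷ t)  = trans (cong (c +_) (deg-bumpLast t)) (+-suc c (deg t))

deg-bumpLast-cong : ∀ {R S} (v : Vec ℕ (suc R)) (w : Vec ℕ (suc S)) →
  deg v ≡ deg w → deg (bumpLast v) ≡ deg (bumpLast w)
deg-bumpLast-cong v w eq = trans (deg-bumpLast v) (trans (cong suc eq) (sym (deg-bumpLast w)))

-- The position of a monomial among those of its degree, in the order which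
-- lists first the monomials free of the first variable x₀ (recursively),
-- then x₀ times the monomials of one degree less.
rank : ∀ {R} → Vec ℕ (suc R) → ℕ
rank {zero}  (c ∷ [])    = 0
rank {suc R} (zero ∷ t)  = rank t
rank {suc R} (suc c ∷ t) = monCount R (deg (suc c ∷ t)) + rank (c ∷ t)

rank-bound : ∀ {R} (v : Vec ℕ (suc R)) → rank v < monCount R (deg v)
rank-bound {zero}  (c ∷ [])    = ≤-reflexive (sym (nCn≡1 (c + 0)))
rank-bound {suc R} (zero ∷ t)  = <-≤-trans (rank-bound t) (C-step (R + deg t) (deg t))
rank-bound {suc R} (suc c ∷ t) =
  subst (rank (suc c ∷ t) <_) (monCount-pascal R (deg (c ∷ t))) (+-monoʳ-< _ (rank-bound (c ∷ t)))

free<multiple : ∀ {R} (t u : Vec ℕ (suc R)) c → deg t ≡ deg (suc c ∷ u) →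
  rank (0 ∷ t) < rank (suc c ∷ u)
free<multiple {R} t u c eq =
  <-≤-trans (subst (λ d → rank t < monCount R d) eq (rank-bound t)) (m≤m+n _ _)

rank-bumpFirst : ∀ {R} (v : Vec ℕ (suc (suc R))) → rank (bumpFirst v) ≡ monCount R (suc (deg v)) + rank v
rank-bumpFirst (c ∷ u) = refl

unrank : ∀ R → ℕ → ℕ → Vec ℕ (suc R)
unrank zero    d       p = d ∷ []
unrank (suc R) zero    p = 0 ∷ unrank R zero p
unrank (suc R) (suc d) p with monCount R (suc d) ≤? p
... | yes _ = bumpFirst (unrank (suc R) d (p ∸ monCount R (suc d)))
... | no  _ = 0 ∷ unrank R (suc d) p

deg-unrank : ∀ R d p → deg (unrank R d p) ≡ d
deg-unrank zero    d       p = +-identityʳ d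
deg-unrank (suc R) zero    p = deg-unrank R zero p
deg-unrank (suc R) (suc d) p with monCount R (suc d) ≤? p
... | yes _ = trans (deg-bumpFirst (unrank (suc R) d q)) (cong suc (deg-unrank (suc R) d q))
  where q = p ∸ monCount R (suc d)
... | no  _ = deg-unrank R (suc d) p

rank-unrank : ∀ R d p → p < monCount R d → rank (unrank R d p) ≡ p
rank-unrank zero    d       p p<1 = sym (n<1⇒n≡0 (subst (p <_) (nCn≡1 d) p<1))
rank-unrank (suc R) zero    p p<1 = rank-unrank R zero p p<1
rank-unrank (suc R) (suc d) p p<N with monCount R (suc d) ≤? p
... | no  p≱K = rank-unrank R (suc d) p (≰⇒> p≱K)
... | yes K≤p = begin
  rank (bumpFirst w)                       ≡⟨ rank-bumpFirst w ⟩
  monCount R (suc (deg w)) + rank w        ≡⟨ cong₂ (λ d′ r → monCount R (suc d′) + r)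
                                                   (deg-unrank (suc R) d q) (rank-unrank (suc R) d q q<N′) ⟩
  monCount R (suc d) + q                   ≡⟨ m+[n∸m]≡n K≤p ⟩
  p                                        ∎
  where
  open ≡-Reasoning
  q = p ∸ monCount R (suc d)
  w = unrank (suc R) d q
  q<N′ : q < monCount (suc R) d
  q<N′ = +-cancelˡ-< (monCount R (suc d)) q _
           (subst₂ _<_ (sym (m+[n∸m]≡n K≤p)) (sym (monCount-pascal R d)) p<N)

unrank-free : ∀ R d p → p < monCount R d → unrank (suc R) d p ≡ 0 ∷ unrank R d p
unrank-free R zero    p _   = refl
unrank-free R (suc d) p p<K with monCount R (suc d) ≤? p
... | yes K≤p = ⊥-elim (<⇒≱ p<K K≤p)
... | no  _   = refl

unrank-multiple : ∀ R d p → monCount R (suc d) ≤ p →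
  unrank (suc R) (suc d) p ≡ bumpFirst (unrank (suc R) d (p ∸ monCount R (suc d)))
unrank-multiple R d p K≤p with monCount R (suc d) ≤? p
... | yes _   = refl
... | no  K≰p = ⊥-elim (K≰p K≤p)

unrank-rank : ∀ {R} (v : Vec ℕ (suc R)) → unrank R (deg v) (rank v) ≡ v
unrank-rank {zero}  (c ∷ [])    = cong (_∷ []) (+-identityʳ c)
unrank-rank {suc R} (zero ∷ t)  = begin
  unrank (suc R) (deg t) (rank t)  ≡⟨ unrank-free R (deg t) (rank t) (rank-bound t) ⟩
  0 ∷ unrank R (deg t) (rank t)    ≡⟨ cong (0 ∷_) (unrank-rank t) ⟩
  0 ∷ t                            ∎
  where open ≡-Reasoning
unrank-rank {suc R} (suc c ∷ t) = begin
  unrank (suc R) (suc D) (K + r)             ≡⟨ unrank-multiple R D (K + r) (m≤m+n K r) ⟩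
  bumpFirst (unrank (suc R) D (K + r ∸ K))   ≡⟨ cong (λ q → bumpFirst (unrank (suc R) D q)) (m+n∸m≡n K r) ⟩
  bumpFirst (unrank (suc R) D r)             ≡⟨ cong bumpFirst (unrank-rank (c ∷ t)) ⟩
  suc c ∷ t                                  ∎
  where
  open ≡-Reasoning
  D = deg (c ∷ t)
  K = monCount R (suc D)
  r = rank (c ∷ t)

rank-bumpLast : ∀ {R} (v : Vec ℕ (suc R)) → rank (bumpLast v) ≡ macaulayUp (deg v) (rank v)
rank-bumpLast {zero}  (c ∷ [])    = sym (macaulayUp-zero (c + 0))
rank-bumpLast {suc R} (zero ∷ t)  = rank-bumpLast t
rank-bumpLast {suc R} (suc c ∷ t) = begin
  monCount R (suc (deg (bumpLast (c ∷ t)))) + rank (bumpLast (c ∷ t))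
    ≡⟨ cong₂ (λ d r′ → monCount R (suc d) + r′) (deg-bumpLast (c ∷ t)) (rank-bumpLast (c ∷ t)) ⟩
  monCount R (suc (suc D)) + macaulayUp D r
    ≡⟨ cong₂ (λ n r′ → n C suc (suc D) + macaulayUp D r′) (+-suc R (suc D)) (sym (m+n∸m≡n K r)) ⟩
  suc k C suc (suc D) + macaulayUp D (K + r ∸ K)
    ≡⟨ sym (macaulayUp-step D (K + r) k 0<K+r k≤ (m≤m+n K r) (rank-bound (suc c ∷ t))) ⟩
  macaulayUp (suc D) (K + r)
    ∎
  where
  open ≡-Reasoning
  D = deg (c ∷ t)
  r = rank (c ∷ t)
  k = R + suc D
  K = k C suc D
  R<K+r : R < K + r
  R<K+r = ≤-trans (monCount-large R D) (m≤m+n K r)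
  0<K+r : 0 < K + r
  0<K+r = ≤-trans (s≤s z≤n) R<K+r
  k≤ : k ≤ K + r + suc D
  k≤ = +-monoˡ-≤ (suc D) (<⇒≤ R<K+r)

bumpLast-mono : ∀ {R} (v w : Vec ℕ (suc R)) → deg v ≡ deg w → rank v ≤ rank w →
  rank (bumpLast v) ≤ rank (bumpLast w)
bumpLast-mono {zero}  (c ∷ [])    (c′ ∷ [])    _  _ = z≤n
bumpLast-mono {suc R} (zero ∷ t)  (zero ∷ u)   eq le = bumpLast-mono t u eq le
bumpLast-mono {suc R} (zero ∷ t)  (suc c ∷ u)  eq le =
  <⇒≤ (free<multiple (bumpLast t) (bumpLast u) c (deg-bumpLast-cong t (suc c ∷ u) eq))
bumpLast-mono {suc R} (suc c ∷ t) (zero ∷ u)   eq le = ⊥-elim (<⇒≱ (free<multiple u t c (sym eq)) le)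
bumpLast-mono {suc R} (suc c ∷ t) (suc c′ ∷ u) eq le =
  +-mono-≤ (≤-reflexive (cong (monCount R) (deg-bumpLast-cong (suc c ∷ t) (suc c′ ∷ u) eq)))
           (bumpLast-mono (c ∷ t) (c′ ∷ u) (suc-injective eq) tails≤)
  where
  tails≤ : rank (c ∷ t) ≤ rank (c′ ∷ u)
  tails≤ = +-cancelˡ-≤ (monCount R (deg (suc c ∷ t))) _ _
             (subst (λ d → rank (suc c ∷ t) ≤ monCount R d + rank (c′ ∷ u)) (sym eq) le)

infix 4 _⋖_
data _⋖_ : ∀ {n} → Vec ℕ n → Vec ℕ n → Set where
  here  : ∀ {n c} {v : Vec ℕ n} → (c ∷ v) ⋖ (suc c ∷ v)
  there : ∀ {n c} {v w : Vec ℕ n} → v ⋖ w → (c ∷ v) ⋖ (c ∷ w)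

deg-⋖ : ∀ {n} {s t : Vec ℕ n} → s ⋖ t → deg t ≡ suc (deg s)
deg-⋖ here                      = refl
deg-⋖ (there {c = c} {v = v} p) = trans (cong (c +_) (deg-⋖ p)) (+-suc c (deg v))

deg-mono : ∀ {n} {s t : Vec ℕ n} → s ∣ᵐ t → deg s ≤ deg t
deg-mono []          = z≤n
deg-mono (a≤b ∷ s∣t) = +-mono-≤ a≤b (deg-mono s∣t)

rank-cons-mono : ∀ {R} c (x y : Vec ℕ (suc R)) → deg x ≡ deg y → rank x ≤ rank y →
  rank (c ∷ x) ≤ rank (c ∷ y)
rank-cons-mono {R} zero    x y eq le = le
rank-cons-mono {R} (suc c) x y eq le =
  +-mono-≤ (≤-reflexive (cong (λ d → monCount R (suc c + d)) eq)) (rank-cons-mono c x y eq le)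

bumpLast≤bumpFirst : ∀ {R} (v : Vec ℕ (suc (suc R))) → rank (bumpLast v) ≤ rank (bumpFirst v)
bumpLast≤bumpFirst (zero ∷ t)  = <⇒≤ (free<multiple (bumpLast t) t 0 (deg-bumpLast t))
bumpLast≤bumpFirst {R} (suc c ∷ t) =
  +-mono-≤ (≤-reflexive (cong (monCount R) (deg-bumpLast (suc c ∷ t)))) (bumpLast≤bumpFirst (c ∷ t))

bumpLast-least : ∀ {R} {s t : Vec ℕ (suc R)} → s ⋖ t → rank (bumpLast s) ≤ rank t
bumpLast-least {zero}  (here {v = []}) = z≤n
bumpLast-least {zero}  (there ())
bumpLast-least {suc R} (here {c = c} {v = v}) = bumpLast≤bumpFirst (c ∷ v)
bumpLast-least {suc R} (there {c = c} {v = v} {w = w} p) =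
  rank-cons-mono c (bumpLast v) w (trans (deg-bumpLast v) (sym (deg-⋖ p))) (bumpLast-least p)

shadow-rank : ∀ {R} {s t : Vec ℕ (suc R)} n → s ⋖ t → n ≤ rank s → macaulayUp (deg s) n ≤ rank t
shadow-rank {R} {s} {t} n s⋖t n≤rank = begin
  macaulayUp (deg s) n                 ≡⟨ sym (cong₂ macaulayUp (deg-unrank R (deg s) n) rank-w) ⟩
  macaulayUp (deg w) (rank w)          ≡⟨ sym (rank-bumpLast w) ⟩
  rank (bumpLast w)                    ≤⟨ bumpLast-mono w s (deg-unrank R (deg s) n)
                                            (≤-trans (≤-reflexive rank-w) n≤rank) ⟩
  rank (bumpLast s)                    ≤⟨ bumpLast-least s⋖t ⟩
  rank t                               ∎
  where
  open ≤-Reasoning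
  w = unrank R (deg s) n
  rank-w : rank w ≡ n
  rank-w = rank-unrank R (deg s) n (≤-<-trans n≤rank (rank-bound s))

divisor-step : ∀ {n} {s t : Vec ℕ n} → s ∣ᵐ t → s ≡ t ⊎ Σ (Vec ℕ n) λ u → s ∣ᵐ u × u ⋖ t
divisor-step {s = []}    {[]}         []             = inj₁ refl
divisor-step {s = a ∷ s} {zero ∷ t}   (z≤n ∷ s∣t)    with divisor-step s∣t
... | inj₁ refl              = inj₁ refl
... | inj₂ (u , s∣u , u⋖t)   = inj₂ (0 ∷ u , z≤n ∷ s∣u , there u⋖t)
divisor-step {s = a ∷ s} {suc b ∷ t}  (a≤1+b ∷ s∣t)  with a ≟ suc b
... | no  a≢1+b = inj₂ (b ∷ t , ≤-pred (≤∧≢⇒< a≤1+b a≢1+b) ∷ s∣t , here)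
... | yes refl with divisor-step s∣t
...   | inj₁ refl            = inj₁ refl
...   | inj₂ (u , s∣u , u⋖t) = inj₂ (suc b ∷ u , ≤-refl ∷ s∣u , there u⋖t)

module Segment (e : ℕ) (g : ℕ → ℕ) (g-O : IsOSequence e g) where

  g0 : g 0 ≡ 1
  g0 = proj₁ g-O

  g-step : ∀ d → 1 ≤ d → d < e → g (suc d) ≤ macaulayUp d (g d)
  g-step = proj₂ g-O

  InSegment : ∀ {R} → Vec ℕ (suc R) → Set
  InSegment v = rank v < g (deg v)

  -- If s had rank ≥ g (deg s), the shadow estimate would give
  -- rank t ≥ (g (deg s)_(deg s))^1_1 ≥ g (deg t), as g is an O-sequence.
  segment-down : ∀ {R} {s t : Vec ℕ (suc R)} → s ⋖ t → deg t ≤ e → InSegment t → InSegment s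
  segment-down {R} {s} {t} s⋖t deg≤e t∈ with deg s in deg-s
  ... | zero = subst (rank s <_) (sym g0) (subst (λ d → rank s < monCount R d) deg-s (rank-bound s))
  ... | suc D with g (suc D) ≤? rank s
  ...   | no  g≰rank   = ≰⇒> g≰rank
  ...   | yes g≤rank   = ⊥-elim (<-irrefl refl (begin-strict
    macaulayUp (suc D) (g (suc D))  ≤⟨ subst (λ d → macaulayUp d (g (suc D)) ≤ rank t) deg-s
                                          (shadow-rank (g (suc D)) s⋖t g≤rank) ⟩
    rank t                          <⟨ subst (λ d → rank t < g d) deg-t t∈ ⟩
    g (suc (suc D))                 ≤⟨ g-step (suc D) (s≤s z≤n)
                                          (subst (_≤ e) deg-t deg≤e) ⟩
    macaulayUp (suc D) (g (suc D))  ∎))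
    where
    open ≤-Reasoning
    deg-t : deg t ≡ suc (suc D)
    deg-t = trans (deg-⋖ s⋖t) (cong suc deg-s)

  segment-closed : ∀ {R} {s t : Vec ℕ (suc R)} → s ∣ᵐ t → deg t ≤ e → InSegment t → InSegment s
  segment-closed {R} {t = t} = go (deg t) refl
    where
    go : ∀ n {s t : Vec ℕ (suc R)} → deg t ≡ n → s ∣ᵐ t → n ≤ e → InSegment t → InSegment s
    go n deg-t s∣t with divisor-step s∣t
    ... | inj₁ refl = λ _ t∈ → t∈
    go zero    deg-t s∣t | inj₂ (u , s∣u , u⋖t) with () ← trans (sym (deg-⋖ u⋖t)) deg-t
    go (suc n) deg-t s∣t | inj₂ (u , s∣u , u⋖t) = λ 1+n≤e t∈ →
      go n (suc-injective (trans (sym (deg-⋖ u⋖t)) deg-t)) s∣u (≤-trans (n≤1+n n) 1+n≤e)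
        (segment-down u⋖t (subst (_≤ e) (sym deg-t) 1+n≤e) t∈)

partialSum : (ℕ → ℕ) → ℕ → ℕ
partialSum f zero    = f 0
partialSum f (suc D) = partialSum f D + f (suc D)

partialSum-cong : ∀ {f f′} → (∀ i → f i ≡ f′ i) → ∀ D → partialSum f D ≡ partialSum f′ D
partialSum-cong f≡f′ zero    = f≡f′ 0
partialSum-cong f≡f′ (suc D) = cong₂ _+_ (partialSum-cong f≡f′ D) (f≡f′ (suc D))

term≤partialSum : ∀ f {d D} → d ≤ D → f d ≤ partialSum f D
term≤partialSum f {D = zero}  z≤n = ≤-refl
term≤partialSum f {D = suc D} d≤ with m≤n⇒m<n∨m≡n d≤
... | inj₁ d<1+D = ≤-trans (term≤partialSum f (≤-pred d<1+D)) (m≤m+n _ _)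
... | inj₂ refl  = m≤n+m _ _

partialSum-Δ : ∀ e h → (∀ d → d < e → h d ≤ h (suc d)) → ∀ D → D ≤ e → partialSum (Δ h) D ≡ h D
partialSum-Δ e h h-mono zero    _   = refl
partialSum-Δ e h h-mono (suc D) D<e =
  trans (cong (_+ (h (suc D) ∸ h D)) (partialSum-Δ e h h-mono D (≤-trans (n≤1+n D) D<e)))
        (m+[n∸m]≡n (h-mono D D<e))

module Graded {A : Set} (φ : A → ℕ) (L : ℕ → List A) where

  upto : ℕ → List A
  upto zero    = L 0
  upto (suc E) = upto E ++ L (suc E)

  length-upto : ∀ E → length (upto E) ≡ partialSum (λ i → length (L i)) E
  length-upto zero    = refl
  length-upto (suc E) = trans (length-++ (upto E)) (cong (_+ length (L (suc E))) (length-upto E))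

  ∈-upto⁺ : ∀ {E i x} → i ≤ E → x ∈ L i → x ∈ upto E
  ∈-upto⁺ {zero}  z≤n x∈ = x∈
  ∈-upto⁺ {suc E} i≤  x∈ with m≤n⇒m<n∨m≡n i≤
  ... | inj₁ i<1+E = ∈-++⁺ˡ (∈-upto⁺ (≤-pred i<1+E) x∈)
  ... | inj₂ refl  = ∈-++⁺ʳ (upto E) x∈

  ∈-upto⁻ : ∀ E {x} → x ∈ upto E → Σ ℕ λ i → i ≤ E × x ∈ L i
  ∈-upto⁻ zero    x∈ = 0 , z≤n , x∈
  ∈-upto⁻ (suc E) x∈ with ∈-++⁻ (upto E) x∈
  ... | inj₁ x∈′ = let i , i≤E , x∈L = ∈-upto⁻ E x∈′ in i , m≤n⇒m≤1+n i≤E , x∈L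
  ... | inj₂ x∈L = suc E , ≤-refl , x∈L

  module _ (graded : ∀ i {x} → x ∈ L i → φ x ≡ i) where

    grade-upto : ∀ E {x} → x ∈ upto E → φ x ≤ E
    grade-upto E x∈ = let i , i≤E , x∈L = ∈-upto⁻ E x∈ in subst (_≤ E) (sym (graded i x∈L)) i≤E

    upto-unique : ∀ E → (∀ i → i ≤ E → Unique (L i)) → Unique (upto E)
    upto-unique zero    uniq = uniq 0 z≤n
    upto-unique (suc E) uniq =
      ++⁺ (upto-unique E (λ i i≤E → uniq i (m≤n⇒m≤1+n i≤E))) (uniq (suc E) ≤-refl)
          (λ (x∈ , x∈L) → 1+n≰n (subst (_≤ E) (graded (suc E) x∈L) (grade-upto E x∈)))

    filter-upto : ∀ {E D} → D ≤ E → filter (λ x → φ x ≟ D) (upto E) ≡ L D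
    filter-upto {zero}  z≤n = filter-all (λ x → φ x ≟ 0) (All.tabulate (graded 0))
    filter-upto {suc E} {D} D≤ with m≤n⇒m<n∨m≡n D≤
    ... | inj₁ D<1+E = begin
      filter P? (upto E ++ L (suc E))           ≡⟨ filter-++ P? (upto E) (L (suc E)) ⟩
      filter P? (upto E) ++ filter P? (L (suc E))
        ≡⟨ cong₂ _++_ (filter-upto (≤-pred D<1+E))
                 (filter-none P? (All.tabulate λ x∈ φx≡D →
                    <-irrefl (trans (sym φx≡D) (graded (suc E) x∈)) D<1+E)) ⟩
      L D ++ []                                 ≡⟨ ++-identityʳ (L D) ⟩
      L D                                       ∎
      where
      open ≡-Reasoning
      P? = λ x → φ x ≟ D
    ... | inj₂ refl = begin
      filter P? (upto E ++ L (suc E))           ≡⟨ filter-++ P? (upto E) (L (suc E)) ⟩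
      filter P? (upto E) ++ filter P? (L (suc E))
        ≡⟨ cong₂ _++_ (filter-none P? (All.tabulate λ x∈ φx≡D →
                         1+n≰n (subst (_≤ E) φx≡D (grade-upto E x∈))))
                      (filter-all P? (All.tabulate (graded (suc E)))) ⟩
      L (suc E)                                 ∎
      where
      open ≡-Reasoning
      P? = λ x → φ x ≟ suc E

-- The pure order ideal realising a differentiable O-sequence h: with
-- g = Δ h and R = h e, it consists of the monomials  x₀^a · t  of degree at
-- most e in R + 2 variables whose part t in the last R + 1 variables lies in
-- the segment of g.  Its degree-D part has  Σ_{k ≤ D} g k = h D  elements.
module Construction (e : ℕ) (h : ℕ → ℕ) (h-mono : ∀ d → d < e → h d ≤ h (suc d))
                    (Δh-O : IsOSequence e (Δ h)) where

  open Segment e (Δ h) Δh-O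

  R : ℕ
  R = h e

  Mon : Set
  Mon = Vec ℕ (suc (suc R))

  Δh≤monCount : ∀ d → d ≤ e → Δ h d ≤ monCount R d
  Δh≤monCount zero    _   = ≤-reflexive g0
  Δh≤monCount (suc d) d<e = <⇒≤ (begin-strict
    Δ h (suc d)          ≤⟨ term≤partialSum (Δ h) d<e ⟩
    partialSum (Δ h) e   ≡⟨ partialSum-Δ e h h-mono e ≤-refl ⟩
    R                    <⟨ monCount-large R d ⟩
    monCount R (suc d)   ∎)
    where open ≤-Reasoning

  block : ℕ → ℕ → List Mon
  block d a = applyUpTo (λ p → a ∷ unrank R d p) (Δ h d)

  block-graded : ∀ d a {m} → m ∈ block d a → deg (tail m) ≡ d
  block-graded d a m∈ with ∈-applyUpTo⁻ _ m∈
  ... | p , _ , refl = deg-unrank R d p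

  ∈-block⁻ : ∀ d a′ {a t} → d ≤ e → (a ∷ t) ∈ block d a′ → a ≡ a′ × deg t ≡ d × InSegment t
  ∈-block⁻ d a′ d≤e m∈ with ∈-applyUpTo⁻ _ m∈
  ... | p , p<Δh , refl =
    refl , deg-unrank R d p ,
    subst₂ _<_ (sym (rank-unrank R d p (<-≤-trans p<Δh (Δh≤monCount d d≤e))))
               (cong (Δ h) (sym (deg-unrank R d p))) p<Δh

  ∈-block⁺ : ∀ a {t} → InSegment t → (a ∷ t) ∈ block (deg t) a
  ∈-block⁺ a {t} t∈ =
    subst (λ u → (a ∷ u) ∈ block (deg t) a) (unrank-rank t) (∈-applyUpTo⁺ _ t∈)

  -- unrank is injective below monCount R d, so blocks have no repetitions.
  block-unique : ∀ d a → d ≤ e → Unique (block d a)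
  block-unique d a d≤e = applyUpTo⁺₁ _ (Δ h d) λ {i} {j} i<j j<Δh a∷uᵢ≡a∷uⱼ →
    <-irrefl (begin
      i                        ≡⟨ sym (rank-unrank R d i (valid (<-trans i<j j<Δh))) ⟩
      rank (unrank R d i)      ≡⟨ cong (λ m → rank (tail m)) a∷uᵢ≡a∷uⱼ ⟩
      rank (unrank R d j)      ≡⟨ rank-unrank R d j (valid j<Δh) ⟩
      j                        ∎) i<j
    where
    open ≡-Reasoning
    valid : ∀ {p} → p < Δ h d → p < monCount R d
    valid p<Δh = <-≤-trans p<Δh (Δh≤monCount d d≤e)

  module Layer (D : ℕ) = Graded (λ m → deg (tail m)) (λ k → block k (D ∸ k))

  layer : ℕ → List Mon
  layer D = Layer.upto D D

  ∈-layer⁻ : ∀ D {a t} → D ≤ e → (a ∷ t) ∈ layer D → a + deg t ≡ D × InSegment t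
  ∈-layer⁻ D D≤e m∈ with Layer.∈-upto⁻ D D m∈
  ... | k , k≤D , m∈block with ∈-block⁻ k (D ∸ k) (≤-trans k≤D D≤e) m∈block
  ...   | refl , deg-t , t∈ = trans (cong (D ∸ k +_) deg-t) (m∸n+n≡m k≤D) , t∈

  layer-graded : ∀ D {m} → m ∈ layer D → deg m ≡ D
  layer-graded D {a ∷ t} m∈ with Layer.∈-upto⁻ D D m∈
  ... | k , k≤D , m∈block with ∈-applyUpTo⁻ _ m∈block
  ...   | p , _ , refl = trans (cong (D ∸ k +_) (deg-unrank R k p)) (m∸n+n≡m k≤D)

  layer-length : ∀ D → D ≤ e → length (layer D) ≡ h D
  layer-length D D≤e = begin
    length (layer D)                                      ≡⟨ Layer.length-upto D D ⟩
    partialSum (λ k → length (block k (D ∸ k))) D         ≡⟨ partialSum-cong (λ k → length-applyUpTo _ (Δ h k)) D ⟩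
    partialSum (Δ h) D                                    ≡⟨ partialSum-Δ e h h-mono D D≤e ⟩
    h D                                                   ∎
    where open ≡-Reasoning

  layer-unique : ∀ D → D ≤ e → Unique (layer D)
  layer-unique D D≤e =
    Layer.upto-unique D (λ k → block-graded k (D ∸ k)) D
      (λ k k≤D → block-unique k (D ∸ k) (≤-trans k≤D D≤e))

  module Ideal = Graded deg layer

  ideal : List Mon
  ideal = Ideal.upto e

  ∈-ideal⁻ : ∀ {a t} → (a ∷ t) ∈ ideal → a + deg t ≤ e × InSegment t
  ∈-ideal⁻ m∈ with Ideal.∈-upto⁻ e m∈
  ... | D , D≤e , m∈layer with ∈-layer⁻ D D≤e m∈layer
  ...   | deg≡D , t∈ = subst (_≤ e) (sym deg≡D) D≤e , t∈

  ∈-ideal⁺ : ∀ a {t} → a + deg t ≤ e → InSegment t → (a ∷ t) ∈ ideal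
  ∈-ideal⁺ a {t} deg≤e t∈ =
    Ideal.∈-upto⁺ deg≤e (Layer.∈-upto⁺ (a + deg t) (m≤n+m (deg t) a)
      (subst (λ a′ → (a ∷ t) ∈ block (deg t) a′) (sym (m+n∸n≡m a (deg t))) (∈-block⁺ a t∈)))

  ideal-unique : Unique ideal
  ideal-unique = Ideal.upto-unique layer-graded e layer-unique

  ideal-count : ∀ D → D ≤ e → countDeg D ideal ≡ h D
  ideal-count D D≤e = trans (cong length (Ideal.filter-upto layer-graded D≤e)) (layer-length D D≤e)

  ideal-nonempty : ideal ≢ []
  ideal-nonempty ideal≡[] = 0≢1+n (trans (cong (countDeg 0) (sym ideal≡[])) (trans (ideal-count 0 z≤n) g0))

  -- Closure under divisors: the x₀-exponent and the degree can only drop,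
  -- and the segment is closed under divisors by Macaulay's theorem.
  ideal-closed : ∀ (m m′ : Mon) → m′ ∈ ideal → m ∣ᵐ m′ → m ∈ ideal
  ideal-closed (a ∷ t) (a′ ∷ t′) m′∈ (a≤a′ ∷ t∣t′) with ∈-ideal⁻ m′∈
  ... | deg≤e , t′∈ =
    ∈-ideal⁺ a (≤-trans (+-mono-≤ a≤a′ (deg-mono t∣t′)) deg≤e)
      (segment-closed t∣t′ (≤-trans (m≤n+m (deg t′) a′) deg≤e) t′∈)

  -- Purity: a monomial of degree below e divides its multiple by x₀, which
  -- still lies in the ideal, so maximal monomials have degree e.
  ideal-pure : IsPureOfDegree e ideal
  ideal-pure (a ∷ t) (m∈ , maximal) with ∈-ideal⁻ m∈
  ... | deg≤e , t∈ with suc (a + deg t) ≤? e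
  ...   | no  deg≮e = ≤-antisym deg≤e (≮⇒≥ deg≮e)
  ...   | yes deg<e = ⊥-elim (1+n≢n (cong head
          (maximal (suc a ∷ t) (∈-ideal⁺ (suc a) deg<e t∈) (n≤1+n a ∷ Pointwise.refl ≤-refl))))

-- Differentiability alone suffices (it already gives h 0 = Δ h 0 = 1).
corollary3p2 : (e : ℕ) (h : ℕ → ℕ) →
    IsOSequence e h → IsDifferentiable e h → IsPureOSequence e h
corollary3p2 e h _ (h-mono , Δh-O) =
  suc (suc R) , ideal ,
  (ideal-nonempty , ideal-unique , ideal-closed) , ideal-pure , ideal-count
  where open Construction e h h-mono Δh-O
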